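{- Let $(X,\le)$ be a non-empty strictly inductive poset, let $a_0\in X$ and let $f:X\to X$. Let $W$ be the set of elements $x\in X$ such that $x=\mathrm{lub}(C)$ for some $a_0$-chain $C$. If $a_0\le f(a_0)$ and $f$ is monotone on $W$ (i.e. $f(x)\le f(y)$ for all $x,y\in W$ with $x\le y$), then $\mathrm{lub}(W)$ exists and is a fixpoint of $f$.
   Context: A poset $(X,\le)$ is strictly inductive if every non-empty chain (totally ordered subset) $Y\subseteq X$ has a least upper bound $\mathrm{lub}(Y)\in X$. A subset $Z\subseteq X$ is closed by non-empty lubs if for every non-empty $P\subseteq Z$, $\mathrm{lub}(P)$ exists and belongs to $Z$. A set $C\subseteq X$ is an $a_0$-chain (with respect to $f$) if: $C$ is well ordered by $\le$; $a_0$ is the least element of $C$; $C$ is closed by non-empty lubs; and for every $z\in C\setminus\{\mathrm{lub}(C)\}$ we have $f(z)\in C$, $z<f(z)$, and there is no $y\in C$ with $z<y<f(z)$. -}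

module Defs where

open import Level using (Level; _⊔_; suc)
open import Data.Product using (Σ; ∃; _×_; _,_)
open import Data.Sum using (_⊎_)
open import Relation.Nullary using (¬_)
open import Relation.Unary using (Pred; Satisfiable; _⊆_)
open import Relation.Binary.Core using (Rel)
open import Relation.Binary.PropositionalEquality using (_≡_; _≢_)

module Order {c ℓ : Level} {X : Set c} (_≤_ : Rel X ℓ) where

  _<_ : X → X → Set (c ⊔ ℓ)
  x < y = (x ≤ y) × (x ≢ y)

  UpperBound : ∀ {p} → Pred X p → X → Set (c ⊔ ℓ ⊔ p)
  UpperBound P x = ∀ {y} → P y → y ≤ x

  IsLub : ∀ {p} → Pred X p → X → Set (c ⊔ ℓ ⊔ p)
  IsLub P x = UpperBound P x × (∀ z → UpperBound P z → x ≤ z)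

  IsChain : ∀ {p} → Pred X p → Set (c ⊔ ℓ ⊔ p)
  IsChain P = ∀ {x y} → P x → P y → (x ≤ y) ⊎ (y ≤ x)

  StrictlyInductive : (p : Level) → Set (c ⊔ ℓ ⊔ suc p)
  StrictlyInductive p = (Y : Pred X p) → Satisfiable Y → IsChain Y → ∃ (IsLub Y)

  ClosedByLubs : ∀ {z} (p : Level) → Pred X z → Set (c ⊔ ℓ ⊔ z ⊔ suc p)
  ClosedByLubs p Z =
    (P : Pred X p) → Satisfiable P → P ⊆ Z → Σ X (λ x → IsLub P x × Z x)

  WellOrdered : ∀ {p} → Pred X p → Set (c ⊔ ℓ ⊔ suc p)
  WellOrdered {p} C =
    IsChain C ×
    ((P : Pred X p) → Satisfiable P → P ⊆ C →
       Σ X (λ x → P x × (∀ {y} → P y → x ≤ y)))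

  IsA₀Chain : ∀ {p} → X → (X → X) → Pred X p → Set (c ⊔ ℓ ⊔ suc p)
  IsA₀Chain {p} a₀ f C =
    WellOrdered C ×
    (C a₀ × (∀ {y} → C y → a₀ ≤ y)) ×
    ClosedByLubs p C ×
    (∀ {z} → C z → ¬ IsLub C z →
       C (f z) × (z < f z) × ¬ (Σ X (λ y → C y × (z < y) × (y < f z))))

  W : (p : Level) → X → (X → X) → Pred X (c ⊔ ℓ ⊔ suc p)
  W p a₀ f x = Σ (Pred X p) (λ C → IsA₀Chain a₀ f C × IsLub C x)

module Submission where

-- Proof strategy (Bourbaki–Witt style comparison of a₀-chains).
--
-- 1. Poset facts: transfinite induction along a well-ordered subset, and
--    the operation `Adjoin C t` of putting an upper bound t on top of a
--    chain C, which preserves well-ordering and (under a mild condition)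
--    closure by lubs; `add-top` turns this into a criterion for C ∪ {t}
--    to be an a₀-chain.
-- 2. Structure of a single a₀-chain C: each x ≠ a₀ of C is a limit point
--    (lub of its predecessors) or a successor point x = f l; initial
--    segments of C are a₀-chains, so every element of C lies in W.
-- 3. Comparison: for two a₀-chains C and D, every x ∈ C either lies in D
--    with D agreeing with C below x, or lies above all of D.  Hence any two
--    a₀-chains are comparable and each is an initial segment of the other.
-- 4. With monotonicity of f on W, every element of W is inflationary.
-- 5. The union of all a₀-chains is a well-ordered chain with lub m; adding
--    m on top gives an a₀-chain, so m ∈ W and m bounds W, i.e. m = lub W.
--    If m < f m, extending this chain by f m puts f m in the union, so
--    f m ≤ m: contradiction.  Hence f m = m.

open import Defs
open import Level using (Level; _⊔_; Lift; lift; lower)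
open import Data.Product using (Σ; _×_; _,_; proj₁; proj₂)
open import Data.Sum using (_⊎_; inj₁; inj₂)
open import Data.Empty using (⊥; ⊥-elim)
open import Relation.Nullary using (¬_; yes; no)
open import Relation.Nullary.Decidable using (True; toWitness; fromWitness; decidable-stable)
open import Relation.Unary using (Pred; Satisfiable; _⊆_)
open import Relation.Binary.Core using (Rel)
open import Relation.Binary.Structures using (IsPartialOrder)
open import Relation.Binary.PropositionalEquality using (_≡_; _≢_; refl; sym; trans; subst; cong)
open import Axiom.ExcludedMiddle using (ExcludedMiddle)

module Classical (em : ∀ {q} → ExcludedMiddle q) where

  by-cases : ∀ {a b} {A : Set a} {B : Set b} → (A → B) → (¬ A → B) → B
  by-cases {A = A} if-yes if-no with em {P = A}
  ... | yes a = if-yes a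
  ... | no ¬a = if-no ¬a

  by-contradiction : ∀ {a} {A : Set a} → ¬ ¬ A → A
  by-contradiction = decidable-stable em

  -- Every proposition has an equivalent copy in any universe (via its
  -- decision); used to form the union of all a₀-chains as a small subset.
  Resized : ∀ {a} (r : Level) → Set a → Set r
  Resized r A = Lift r (True (em {P = A}))

  resize : ∀ {a r} {A : Set a} → A → Resized r A
  resize a = lift (fromWitness a)

  unresize : ∀ {a r} {A : Set a} → Resized r A → A
  unresize r = toWitness (lower r)

module Proof {c ℓ} {X : Set c} {_≤_ : Rel X ℓ}
  (em : ∀ {q} → ExcludedMiddle q) (po : IsPartialOrder _≡_ _≤_) where

  open Classical em
  open Order _≤_
  open IsPartialOrder po using (antisym) renaming (trans to ≤-trans; reflexive to ≤-reflexive)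

  p : Level
  p = c ⊔ ℓ

  <⇒≱ : ∀ {x y} → x < y → ¬ (y ≤ x)
  <⇒≱ (x≤y , x≢y) y≤x = x≢y (antisym x≤y y≤x)

  <-≤-trans : ∀ {x y z} → x < y → y ≤ z → x < z
  <-≤-trans x<y y≤z = ≤-trans (proj₁ x<y) y≤z , λ { refl → <⇒≱ x<y y≤z }

  ≤-<-trans : ∀ {x y z} → x ≤ y → y < z → x < z
  ≤-<-trans x≤y y<z = ≤-trans x≤y (proj₁ y<z) , λ { refl → <⇒≱ y<z x≤y }

  lub-unique : ∀ {q} {P : Pred X q} {x y} → IsLub P x → IsLub P y → x ≡ y
  lub-unique {x = x} {y} x-lub y-lub =
    antisym (proj₂ x-lub y (proj₁ y-lub)) (proj₂ y-lub x (proj₁ x-lub))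

  bound-or-escape : ∀ {q} (S : Pred X q) (y : X) →
    UpperBound S y ⊎ Σ X (λ s → S s × ¬ (s ≤ y))
  bound-or-escape S y =
    by-cases inj₂ (λ none → inj₁ (λ {s} s∈S → by-contradiction (λ s≰y → none (s , s∈S , s≰y))))

  Least : ∀ {q} → Pred X q → X → Set (c ⊔ ℓ ⊔ q)
  Least P x = P x × (∀ {y} → P y → x ≤ y)

  -- Transfinite induction along a well-ordered subset: a minimal
  -- counterexample would contradict the induction step.
  wo-induction : ∀ {q} {C : Pred X q} → WellOrdered C → (P : Pred X q) →
    (∀ {x} → C x → (∀ {y} → C y → y < x → P y) → P x) → ∀ {x} → C x → P x
  wo-induction {q} {C} (_ , least-of) P step {x} cx =
    by-contradiction λ ¬Px → no-minimal-counterexample (least-of Bad (x , cx , ¬Px) proj₁)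
    where
    Bad : Pred X q
    Bad y = C y × ¬ P y
    no-minimal-counterexample : ¬ Σ X (Least Bad)
    no-minimal-counterexample (m , (cm , ¬Pm) , m-least) =
      ¬Pm (step cm (λ cy y<m → by-contradiction (λ ¬Py → <⇒≱ y<m (m-least (cy , ¬Py)))))

  Adjoin : Pred X p → X → Pred X p
  Adjoin C t y = C y ⊎ (y ≡ t)

  module AddTop {C : Pred X p} {t : X} (C≤t : UpperBound C t) where

    below-top : UpperBound (Adjoin C t) t
    below-top (inj₁ cy) = C≤t cy
    below-top (inj₂ y≡t) = ≤-reflexive y≡t

    top-is-lub : IsLub (Adjoin C t) t
    top-is-lub = below-top , λ u t-ub → t-ub (inj₂ refl)

    chain⁺ : IsChain C → IsChain (Adjoin C t)
    chain⁺ chain (inj₁ cx) (inj₁ cy) = chain cx cy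
    chain⁺ chain cx (inj₂ refl) = inj₁ (below-top cx)
    chain⁺ chain (inj₂ refl) cy = inj₂ (below-top cy)

    -- A subset of C ∪ {t} meeting C has the least element of its part in
    -- C as least element; otherwise it is {t}.
    well-ordered⁺ : WellOrdered C → WellOrdered (Adjoin C t)
    well-ordered⁺ (chain , least-of) = chain⁺ chain , least-of⁺
      where
      least-of⁺ : (P : Pred X p) → Satisfiable P → P ⊆ Adjoin C t → Σ X (Least P)
      least-of⁺ P (x , px) P⊆C⁺ = by-cases meets-C (λ misses → only-top misses (P⊆C⁺ px))
        where
        meets-C : Σ X (λ y → P y × C y) → Σ X (Least P)
        meets-C y∈P∩C with least-of (λ u → P u × C u) y∈P∩C proj₂
        ... | l , (pl , cl) , l-least = l , pl , λ pu → l≤ (P⊆C⁺ pu) pu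
          where
          l≤ : ∀ {u} → Adjoin C t u → P u → l ≤ u
          l≤ (inj₁ cu) pu = l-least (pu , cu)
          l≤ (inj₂ refl) _ = C≤t cl
        only-top : ¬ Σ X (λ y → P y × C y) → Adjoin C t x → Σ X (Least P)
        only-top misses (inj₁ cx) = ⊥-elim (misses (x , px , cx))
        only-top misses (inj₂ x≡t) = x , px , λ pu → x≤ (P⊆C⁺ pu) pu
          where
          x≤ : ∀ {u} → Adjoin C t u → P u → x ≤ u
          x≤ {u} (inj₁ cu) pu = ⊥-elim (misses (u , pu , cu))
          x≤ (inj₂ u≡t) _ = ≤-reflexive (trans x≡t (sym u≡t))

    closed⁺ : ((P : Pred X p) → Satisfiable P → P ⊆ C → Σ X (λ x → IsLub P x × Adjoin C t x)) →
              ClosedByLubs p (Adjoin C t)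
    closed⁺ lub-of P nonempty P⊆C⁺ = by-cases top-in-P (λ t∉P → lub-of P nonempty (P⊆C t∉P))
      where
      top-in-P : P t → Σ X (λ x → IsLub P x × Adjoin C t x)
      top-in-P pt = t , ((λ py → below-top (P⊆C⁺ py)) , λ u u-ub → u-ub pt) , inj₂ refl
      P⊆C : ¬ P t → P ⊆ C
      P⊆C t∉P {y} py with P⊆C⁺ py
      ... | inj₁ cy = cy
      ... | inj₂ refl = ⊥-elim (t∉P py)

  module A₀Chains (a₀ : X) (f : X → X) where

    A₀Chain : Pred X p → Set (Level.suc p)
    A₀Chain = IsA₀Chain a₀ f

    Successor : Pred X p → X → Set p
    Successor C z = C (f z) × (z < f z) × ¬ (Σ X (λ y → C y × (z < y) × (y < f z)))

    module _ {C : Pred X p} (A : A₀Chain C) where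
      well-ordered : WellOrdered C
      well-ordered = proj₁ A
      chain : IsChain C
      chain = proj₁ well-ordered
      has-a₀ : C a₀
      has-a₀ = proj₁ (proj₁ (proj₂ A))
      a₀-least : ∀ {y} → C y → a₀ ≤ y
      a₀-least = proj₂ (proj₁ (proj₂ A))
      closed : ClosedByLubs p C
      closed = proj₁ (proj₂ (proj₂ A))
      successor : ∀ {z} → C z → ¬ IsLub C z → Successor C z
      successor = proj₂ (proj₂ (proj₂ A))

    add-top : ∀ {C t} (C≤t : UpperBound C t) → WellOrdered C →
      (∀ {y} → C y → a₀ ≤ y) → Adjoin C t a₀ →
      ((P : Pred X p) → Satisfiable P → P ⊆ C → Σ X (λ x → IsLub P x × Adjoin C t x)) →
      (∀ {w} → C w → ¬ IsLub (Adjoin C t) w → Successor (Adjoin C t) w) →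
      A₀Chain (Adjoin C t)
    add-top {C} {t} C≤t wo a₀≤C a₀∈C⁺ lub-of succ =
      well-ordered⁺ wo , (a₀∈C⁺ , a₀-least⁺) , closed⁺ lub-of , succ⁺
      where
      open AddTop C≤t
      a₀-least⁺ : ∀ {y} → Adjoin C t y → a₀ ≤ y
      a₀-least⁺ (inj₁ cy) = a₀≤C cy
      a₀-least⁺ (inj₂ refl) = below-top a₀∈C⁺
      succ⁺ : ∀ {w} → Adjoin C t w → ¬ IsLub (Adjoin C t) w → Successor (Adjoin C t) w
      succ⁺ (inj₁ cw) = succ cw
      succ⁺ (inj₂ refl) not-lub = ⊥-elim (not-lub top-is-lub)

    singleton : A₀Chain (Adjoin (λ _ → Lift p ⊥) a₀)
    singleton = add-top (λ { (lift ()) })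
      ((λ { (lift ()) }) , λ { P (_ , px) P⊆∅ → ⊥-elim (lower (P⊆∅ px)) })
      (λ { (lift ()) }) (inj₂ refl)
      (λ { P (_ , px) P⊆∅ → ⊥-elim (lower (P⊆∅ px)) })
      (λ { (lift ()) })

    extend : ∀ {C} → A₀Chain C → ∀ {z} → C z → IsLub C z → z < f z → A₀Chain (Adjoin C (f z))
    extend {C} A {z} cz z-lub z<fz =
      add-top C≤fz (well-ordered A) (a₀-least A) (inj₁ (has-a₀ A)) lub-of succ
      where
      C≤fz : UpperBound C (f z)
      C≤fz cy = ≤-trans (proj₁ z-lub cy) (proj₁ z<fz)
      lub-of : (P : Pred X p) → Satisfiable P → P ⊆ C → Σ X (λ x → IsLub P x × Adjoin C (f z) x)
      lub-of P nonempty P⊆C with closed A P nonempty P⊆C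
      ... | l , l-lub , cl = l , l-lub , inj₁ cl
      -- at the top z the successor is the new element; below z it is C's own
      succ : ∀ {w} → C w → ¬ IsLub (Adjoin C (f z)) w → Successor (Adjoin C (f z)) w
      succ {w} cw _ = by-cases at-top (λ not-top → below-z (successor A cw not-top))
        where
        at-top : IsLub C w → Successor (Adjoin C (f z)) w
        at-top w-lub = inj₂ (cong f w≡z) , subst (λ u → u < f u) (sym w≡z) z<fz , nothing-between
          where
          w≡z : w ≡ z
          w≡z = lub-unique w-lub z-lub
          nothing-between : ¬ Σ X (λ y → Adjoin C (f z) y × (w < y) × (y < f w))
          nothing-between (y , inj₁ cy , w<y , _) = <⇒≱ w<y (proj₁ w-lub cy)
          nothing-between (y , inj₂ y≡fz , _ , y<fw) = proj₂ y<fw (trans y≡fz (sym (cong f w≡z)))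
        below-z : Successor C w → Successor (Adjoin C (f z)) w
        below-z (cfw , w<fw , nothing-in-C) = inj₁ cfw , w<fw , nothing-between
          where
          nothing-between : ¬ Σ X (λ y → Adjoin C (f z) y × (w < y) × (y < f w))
          nothing-between (y , inj₁ cy , w<y , y<fw) = nothing-in-C (y , cy , w<y , y<fw)
          nothing-between (y , inj₂ refl , _ , y<fw) = <⇒≱ y<fw (C≤fz cfw)

    next-is-successor : ∀ {C} → A₀Chain C → ∀ {l x} → C l → C x → l < x →
      (∀ {u} → C u → u < x → u ≤ l) → f l ≡ x
    next-is-successor A {l} {x} cl cx l<x below-x≤l
      with successor A cl (λ l-lub → <⇒≱ l<x (proj₁ l-lub cx))
    ... | cfl , l<fl , nothing-between with chain A cfl cx
    ...   | inj₁ fl≤x = by-contradiction λ fl≢x → <⇒≱ l<fl (below-x≤l cfl (fl≤x , fl≢x))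
    ...   | inj₂ x≤fl = by-contradiction λ fl≢x →
              nothing-between (x , cx , l<x , x≤fl , λ x≡fl → fl≢x (sym x≡fl))

    Below : Pred X p → X → Pred X p
    Below C x u = C u × u < x

    data Shape (C : Pred X p) (x : X) : Set p where
      limit-point     : IsLub (Below C x) x → Shape C x
      successor-point : ∀ {l} → C l → l < x → f l ≡ x → Shape C x

    -- The lub l of the predecessors of x lies in C; either l = x or x = f l.
    shape : ∀ {C} → A₀Chain C → ∀ {x} → C x → x ≢ a₀ → Shape C x
    shape {C} A {x} cx x≢a₀
      with closed A (Below C x) (a₀ , has-a₀ A , a₀-least A cx , λ a₀≡x → x≢a₀ (sym a₀≡x)) proj₁
    ... | l , l-lub , cl = by-cases
      (λ l≡x → limit-point (subst (IsLub (Below C x)) l≡x l-lub))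
      (λ l≢x → successor-point cl (l≤x , l≢x)
        (next-is-successor A cl cx (l≤x , l≢x) (λ cu u<x → proj₁ l-lub (cu , u<x))))
      where
      l≤x : l ≤ x
      l≤x = proj₂ l-lub x (λ u∈Below → proj₁ (proj₂ u∈Below))

    UpTo : Pred X p → X → Pred X p
    UpTo C y u = C u × u ≤ y

    up-to-lub : ∀ {C y} → C y → IsLub (UpTo C y) y
    up-to-lub cy = proj₂ , λ u u-ub → u-ub (cy , ≤-reflexive refl)

    segment : ∀ {C} → A₀Chain C → ∀ {y} → C y → A₀Chain (UpTo C y)
    segment {C} A {y} cy =
      ((λ u v → chain A (proj₁ u) (proj₁ v)) ,
       (λ P nonempty P⊆ → proj₂ (well-ordered A) P nonempty (λ pu → proj₁ (P⊆ pu)))) ,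
      ((has-a₀ A , a₀-least A cy) , (λ u → a₀-least A (proj₁ u))) ,
      closed-segment , successor-segment
      where
      closed-segment : ClosedByLubs p (UpTo C y)
      closed-segment P nonempty P⊆ with closed A P nonempty (λ pu → proj₁ (P⊆ pu))
      ... | l , l-lub , cl = l , l-lub , cl , proj₂ l-lub y (λ pu → proj₂ (P⊆ pu))
      successor-segment : ∀ {w} → UpTo C y w → ¬ IsLub (UpTo C y) w → Successor (UpTo C y) w
      successor-segment {w} (cw , w≤y) not-lub =
        from-C (successor A cw (λ w-lub → w≢y (antisym w≤y (proj₁ w-lub cy))))
        where
        w≢y : w ≢ y
        w≢y w≡y = not-lub (subst (IsLub (UpTo C y)) (sym w≡y) (up-to-lub cy))
        from-C : Successor C w → Successor (UpTo C y) w
        from-C (cfw , w<fw , nothing-between) =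
          (cfw , fw≤y) , w<fw , λ { (v , (cv , _) , w<v , v<fw) → nothing-between (v , cv , w<v , v<fw) }
          where
          -- y itself cannot lie strictly between w and f w
          fw≤y : f w ≤ y
          fw≤y with chain A cfw cy
          ... | inj₁ fw≤y = fw≤y
          ... | inj₂ y≤fw = by-cases (λ y≡fw → ≤-reflexive (sym y≡fw))
                  (λ y≢fw → ⊥-elim (nothing-between (y , cy , (w≤y , w≢y) , (y≤fw , y≢fw))))

    in-W : ∀ {C} → A₀Chain C → ∀ {y} → C y → W p a₀ f y
    in-W A cy = _ , segment A cy , up-to-lub cy

    AgreesUpTo : Pred X p → Pred X p → X → Set p
    AgreesUpTo C D x = D x × (∀ {y} → D y → y ≤ x → C y)

    ExhaustedBelow : Pred X p → Pred X p → X → Set p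
    ExhaustedBelow C D x = ∀ {y} → D y → Below C x y

    Comparison : Pred X p → Pred X p → X → Set p
    Comparison C D x = AgreesUpTo C D x ⊎ ExhaustedBelow C D x

    -- below a₀ there is nothing but a₀ itself
    agree-at-a₀ : ∀ {C D} → A₀Chain D → C a₀ → AgreesUpTo C D a₀
    agree-at-a₀ {C} B ca₀ = has-a₀ B , λ dy y≤a₀ → subst C (antisym (a₀-least B dy) y≤a₀) ca₀

    -- At a limit point x, D contains the lub x of the predecessors (which all
    -- lie in D), and an element of D below x is below some predecessor.
    agree-at-limit : ∀ {C D} → A₀Chain C → A₀Chain D → ∀ {x} → C x → x ≢ a₀ →
      IsLub (Below C x) x → (∀ {y} → Below C x y → AgreesUpTo C D y) → AgreesUpTo C D x
    agree-at-limit {C} {D} A B {x} cx x≢a₀ x-lub earlier = dx , agree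
      where
      dx : D x
      dx with closed B (Below C x) (a₀ , has-a₀ A , a₀-least A cx , λ a₀≡x → x≢a₀ (sym a₀≡x))
                       (λ b → proj₁ (earlier b))
      ... | l , l-lub , dl = subst D (lub-unique l-lub x-lub) dl
      agree : ∀ {y} → D y → y ≤ x → C y
      agree {y} dy y≤x with bound-or-escape (Below C x) y
      ... | inj₁ y-ub = subst C (antisym (proj₂ x-lub y y-ub) y≤x) cx
      ... | inj₂ (s , bs , s≰y) with chain B dy (proj₁ (earlier bs))
      ...   | inj₁ y≤s = proj₂ (earlier bs) dy y≤s
      ...   | inj₂ s≤y = ⊥-elim (s≰y s≤y)

    -- At a successor point x = f l where l is not the top of D, D continues
    -- with f l, and nothing of D lies strictly between l and x.
    agree-at-successor : ∀ {C D} → A₀Chain D → ∀ {l x} → C l → C x → l < x → f l ≡ x →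
      AgreesUpTo C D l → ¬ IsLub D l → AgreesUpTo C D x
    agree-at-successor {C} {D} B {l} {x} cl cx l<x fl≡x (dl , agree-l) l-not-top =
      from-D (successor B dl l-not-top)
      where
      from-D : Successor D l → AgreesUpTo C D x
      from-D (dfl , _ , nothing-between) = subst D fl≡x dfl , agree
        where
        agree : ∀ {y} → D y → y ≤ x → C y
        agree {y} dy y≤x with chain B dy dl
        ... | inj₁ y≤l = agree-l dy y≤l
        ... | inj₂ l≤y =
          by-cases (λ y≡l → subst C (sym y≡l) cl) λ y≢l →
          by-cases (λ y≡x → subst C (sym y≡x) cx) λ y≢x →
          ⊥-elim (nothing-between (y , dy , (l≤y , λ l≡y → y≢l (sym l≡y)) ,
                                   subst (y <_) (sym fl≡x) (y≤x , y≢x)))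

    -- Comparison of two a₀-chains, by induction along C: if D is already
    -- exhausted below a predecessor it is exhausted below x; otherwise D
    -- agrees with C below every predecessor and we conclude by the shape of x.
    compare : ∀ {C D} → A₀Chain C → A₀Chain D → ∀ {x} → C x → Comparison C D x
    compare {C} {D} A B = wo-induction (well-ordered A) (Comparison C D) step
      where
      step : ∀ {x} → C x → (∀ {y} → C y → y < x → Comparison C D y) → Comparison C D x
      step {x} cx ih = by-cases exhausted-earlier (λ none → agreement (earlier-agree none))
        where
        exhausted-earlier : Σ X (λ y → Below C x y × ExhaustedBelow C D y) → Comparison C D x
        exhausted-earlier (_ , (_ , y<x) , D<y) =
          inj₂ λ dv → proj₁ (D<y dv) , <-≤-trans (proj₂ (D<y dv)) (proj₁ y<x)
        earlier-agree : ¬ Σ X (λ y → Below C x y × ExhaustedBelow C D y) →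
          ∀ {y} → Below C x y → AgreesUpTo C D y
        earlier-agree none {y} (cy , y<x) with ih cy y<x
        ... | inj₁ agrees = agrees
        ... | inj₂ exhausted = ⊥-elim (none (y , (cy , y<x) , exhausted))
        agreement : (∀ {y} → Below C x y → AgreesUpTo C D y) → Comparison C D x
        agreement earlier =
          by-cases (λ x≡a₀ → inj₁ (subst (AgreesUpTo C D) (sym x≡a₀)
                                          (agree-at-a₀ B (subst C x≡a₀ cx))))
                   (λ x≢a₀ → by-shape x≢a₀ (shape A cx x≢a₀))
          where
          by-shape : x ≢ a₀ → Shape C x → Comparison C D x
          by-shape x≢a₀ (limit-point x-lub) = inj₁ (agree-at-limit A B cx x≢a₀ x-lub earlier)
          by-shape _ (successor-point {l} cl l<x fl≡x) = by-cases {A = IsLub D l}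
            (λ l-top → inj₂ λ {v} dv → proj₂ (earlier (cl , l<x)) dv (proj₁ l-top dv) ,
                                    ≤-<-trans (proj₁ l-top dv) l<x)
            (λ l-not-top → inj₁ (agree-at-successor B cl cx l<x fl≡x (earlier (cl , l<x)) l-not-top))

    comparable : ∀ {C D} → A₀Chain C → A₀Chain D → ∀ {x y} → C x → D y → (x ≤ y) ⊎ (y ≤ x)
    comparable A B cx dy with compare A B cx
    ... | inj₁ (dx , _) = chain B dx dy
    ... | inj₂ D<x = inj₂ (proj₁ (proj₂ (D<x dy)))

    initial : ∀ {C D} → A₀Chain C → A₀Chain D → ∀ {x y} → C x → D y → y ≤ x → C y
    initial A B cx dy y≤x with compare A B cx
    ... | inj₁ (_ , agree) = agree dy y≤x
    ... | inj₂ D<x = proj₁ (D<x dy)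

    module Inflationary (a₀≤fa₀ : a₀ ≤ f a₀)
      (mono : ∀ {x y} → W p a₀ f x → W p a₀ f y → x ≤ y → f x ≤ f y) where

      -- by induction along the chain: at a₀ by hypothesis, at a limit point
      -- since every predecessor y satisfies y ≤ f y ≤ f x, at a successor
      -- point x = f l since l ≤ x gives x = f l ≤ f x
      chain-inflationary : ∀ {C} → A₀Chain C → ∀ {x} → C x → x ≤ f x
      chain-inflationary {C} A cx = lower (wo-induction (well-ordered A) (λ y → Lift c (y ≤ f y)) step cx)
        where
        step : ∀ {x} → C x → (∀ {y} → C y → y < x → Lift c (y ≤ f y)) → Lift c (x ≤ f x)
        step {x} cx ih = lift (by-cases (λ x≡a₀ → subst (λ u → u ≤ f u) (sym x≡a₀) a₀≤fa₀)
                                        (λ x≢a₀ → by-shape (shape A cx x≢a₀)))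
          where
          by-shape : Shape C x → x ≤ f x
          by-shape (limit-point x-lub) = proj₂ x-lub (f x) λ { (cy , y<x) →
            ≤-trans (lower (ih cy y<x)) (mono (in-W A cy) (in-W A cx) (proj₁ y<x)) }
          by-shape (successor-point cl l<x fl≡x) =
            subst (_≤ f _) fl≡x (mono (in-W A cl) (in-W A cx) (proj₁ l<x))

      -- x = lub C and y ≤ f y ≤ f x for every y ∈ C
      W-inflationary : ∀ {x} → W p a₀ f x → x ≤ f x
      W-inflationary x∈W@(C , A , x-lub) =
        proj₂ x-lub _ (λ cy → ≤-trans (chain-inflationary A cy) (mono (in-W A cy) x∈W (proj₁ x-lub cy)))

    OnSomeChain : X → Set (Level.suc p)
    OnSomeChain x = Σ (Pred X p) (λ C → A₀Chain C × C x)

    Union : Pred X p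
    Union x = Resized p (OnSomeChain x)

    a₀∈Union : Union a₀
    a₀∈Union = resize (_ , singleton , inj₂ refl)

    a₀≤Union : ∀ {y} → Union y → a₀ ≤ y
    a₀≤Union y∈U with unresize y∈U
    ... | _ , A , cy = a₀-least A cy

    union-chain : IsChain Union
    union-chain x∈U y∈U with unresize x∈U | unresize y∈U
    ... | _ , A , cx | _ , B , dy = comparable A B cx dy

    -- The least element of P ∩ C, for any chain C meeting P, is least in P:
    -- the elements of P below it lie in C.
    union-well-ordered : WellOrdered Union
    union-well-ordered = union-chain , least-of
      where
      least-of : (P : Pred X p) → Satisfiable P → P ⊆ Union → Σ X (Least P)
      least-of P (x , px) P⊆U with unresize (P⊆U px)
      ... | C , A , cx with proj₂ (well-ordered A) (λ u → P u × C u) (x , px , cx) proj₂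
      ...   | l , (pl , cl) , l-least = l , pl , λ py → l≤ (unresize (P⊆U py)) py
        where
        l≤ : ∀ {y} → OnSomeChain y → P y → l ≤ y
        l≤ (D , B , dy) py with comparable A B cl dy
        ... | inj₁ l≤y = l≤y
        ... | inj₂ y≤l = l-least (py , initial A B cl dy y≤l)

    union-lub : StrictlyInductive p → Σ X (IsLub Union)
    union-lub si = si Union (a₀ , a₀∈Union) union-chain

    module TopOfUnion (si : StrictlyInductive p) {m : X} (m-lub : IsLub Union m) where

      Union≤m : UpperBound Union m
      Union≤m = proj₁ m-lub

      m-is-lub⁺ : IsLub (Adjoin Union m) m
      m-is-lub⁺ = AddTop.top-is-lub Union≤m

      -- A subset of the union bounded by an element d of the union lies in
      -- d's chain, which contains its lub.
      bounded-lub-in-union : ∀ {P : Pred X p} → Satisfiable P → P ⊆ Union →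
        ∀ {d l} → Union d → UpperBound P d → IsLub P l → Union l
      bounded-lub-in-union {P} nonempty P⊆U {d} {l} d∈U P≤d l-lub = from-chain (unresize d∈U)
        where
        from-chain : OnSomeChain d → Union l
        from-chain (D , B , dd) = in-D (closed B P nonempty P⊆D)
          where
          P⊆D : P ⊆ D
          P⊆D py with unresize (P⊆U py)
          ... | E , B′ , ey = initial B B′ dd ey (P≤d py)
          in-D : Σ X (λ x → IsLub P x × D x) → Union l
          in-D (l′ , l′-lub , dl′) = resize (D , B , subst D (lub-unique l′-lub l-lub) dl′)

      unbounded-lub-is-m : ∀ {P : Pred X p} → P ⊆ Union →
        ¬ Σ X (λ d → Union d × UpperBound P d) → ∀ {l} → IsLub P l → l ≡ m
      unbounded-lub-is-m {P} P⊆U unbounded {l} l-lub =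
        antisym (proj₂ l-lub m (λ py → Union≤m (P⊆U py))) (proj₂ m-lub l Union≤l)
        where
        Union≤l : UpperBound Union l
        Union≤l {y} y∈U with bound-or-escape P y
        ... | inj₁ P≤y = ⊥-elim (unbounded (y , y∈U , P≤y))
        ... | inj₂ (s , ps , s≰y) = below-escapee (union-chain y∈U (P⊆U ps))
          where
          below-escapee : (y ≤ s) ⊎ (s ≤ y) → y ≤ l
          below-escapee (inj₁ y≤s) = ≤-trans y≤s (proj₁ l-lub ps)
          below-escapee (inj₂ s≤y) = ⊥-elim (s≰y s≤y)

      union-lubs : (P : Pred X p) → Satisfiable P → P ⊆ Union →
        Σ X (λ x → IsLub P x × Adjoin Union m x)
      union-lubs P nonempty P⊆U = locate (si P nonempty (λ px py → union-chain (P⊆U px) (P⊆U py)))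
        where
        locate : Σ X (IsLub P) → Σ X (λ x → IsLub P x × Adjoin Union m x)
        locate (l , l-lub) = l , l-lub , by-cases {A = Σ X (λ d → Union d × UpperBound P d)}
          (λ { (d , d∈U , P≤d) → inj₁ (bounded-lub-in-union nonempty P⊆U d∈U P≤d l-lub) })
          (λ unbounded → inj₂ (unbounded-lub-is-m P⊆U unbounded l-lub))

      -- Below m, an element w of the union is exceeded by some y on a chain D;
      -- w ∈ D is not the top of D, so D supplies the successor f w, and no
      -- element of the union lies strictly between w and f w.
      union-successor : ∀ {w} → Union w → ¬ IsLub (Adjoin Union m) w → Successor (Adjoin Union m) w
      union-successor {w} w∈U w-not-lub with bound-or-escape Union w
      ... | inj₁ Union≤w = ⊥-elim (w-not-lub (subst (IsLub (Adjoin Union m)) (sym w≡m) m-is-lub⁺))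
        where
        w≡m : w ≡ m
        w≡m = antisym (Union≤m w∈U) (proj₂ m-lub w Union≤w)
      ... | inj₂ (y , y∈U , y≰w) = from-chains (unresize w∈U) (unresize y∈U)
        where
        from-chains : OnSomeChain w → OnSomeChain y → Successor (Adjoin Union m) w
        from-chains (C , A , cw) (D , B , dy) with comparable A B cw dy
        ... | inj₂ y≤w = ⊥-elim (y≰w y≤w)
        ... | inj₁ w≤y = from-D (successor B (initial B A dy cw w≤y) (λ w-top → y≰w (proj₁ w-top dy)))
          where
          from-D : Successor D w → Successor (Adjoin Union m) w
          from-D (dfw , w<fw , nothing-in-D) = fw∈U⁺ , w<fw , nothing-between
            where
            fw∈U⁺ : Adjoin Union m (f w)
            fw∈U⁺ = inj₁ (resize (D , B , dfw))
            nothing-between : ¬ Σ X (λ v → Adjoin Union m v × (w < v) × (v < f w))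
            nothing-between (v , inj₁ v∈U , w<v , v<fw) with unresize v∈U
            ... | E , B′ , ev = nothing-in-D (v , initial B B′ dfw ev (proj₁ v<fw) , w<v , v<fw)
            nothing-between (v , inj₂ v≡m , _ , v<fw) =
              <⇒≱ v<fw (subst (f w ≤_) (sym v≡m) (AddTop.below-top Union≤m fw∈U⁺))

      union⁺-chain : A₀Chain (Adjoin Union m)
      union⁺-chain = add-top Union≤m union-well-ordered a₀≤Union (inj₁ a₀∈Union)
                             union-lubs union-successor

      m∈W : W p a₀ f m
      m∈W = Adjoin Union m , union⁺-chain , m-is-lub⁺

      -- m bounds W: the chain of every element of W lies in the union.
      W≤m : UpperBound (W p a₀ f) m
      W≤m (C , A , x-lub) = proj₂ x-lub m (λ cy → Union≤m (resize (C , A , cy)))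

      -- If m < f m, extending the a₀-chain union ∪ {m} by f m yields an
      -- a₀-chain containing f m, so f m ≤ m: contradiction.
      m-fixed : m ≤ f m → f m ≡ m
      m-fixed m≤fm = by-contradiction λ fm≢m →
        let m<fm = m≤fm , (λ m≡fm → fm≢m (sym m≡fm))
            fm∈Union = resize (_ , extend union⁺-chain (inj₂ refl) m-is-lub⁺ m<fm , inj₂ refl)
        in <⇒≱ m<fm (Union≤m fm∈Union)

theorem2 : ∀ {c ℓ} (X : Set c) (_≤_ : Rel X ℓ) →
    (∀ {q} → ExcludedMiddle q) →
    IsPartialOrder _≡_ _≤_ →
    (∀ {p} → Order.StrictlyInductive _≤_ p) →
    (a₀ : X) (f : X → X) →
    a₀ ≤ f a₀ →
    (∀ {x y} → Order.W _≤_ (c ⊔ ℓ) a₀ f x → Order.W _≤_ (c ⊔ ℓ) a₀ f y → x ≤ y → f x ≤ f y) →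
    Σ X (λ m → Order.IsLub _≤_ (Order.W _≤_ (c ⊔ ℓ) a₀ f) m × (f m ≡ m))
theorem2 X _≤_ em po si a₀ f a₀≤fa₀ mono = fixpoint (union-lub si)
  where
  open Proof em po
  open A₀Chains a₀ f
  open Inflationary a₀≤fa₀ mono
  open Order _≤_ using (IsLub; W)
  fixpoint : Σ X (IsLub Union) → Σ X (λ m → IsLub (W p a₀ f) m × (f m ≡ m))
  fixpoint (m , m-lub) = m , (W≤m , λ u W≤u → W≤u m∈W) , m-fixed (W-inflationary m∈W)
    where open TopOfUnion si m-lub
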